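{- Let $A$ and $B$ be time series, let $d_{A,B}$ be a dissimilarity function with nonnegative integer values and let $c=\max_{i,j} d_{A,B}(i,j)$. Let $R_{A,B}$ be the weighted integer sequence defined in the context. Suppose that for every subsequence $q\circ q'$ of $R_{A,B}$ (two elements $q,q'$ with $f(q)<f(q')$), $q\circ q'$ is a maximal increasing subsequence of $R_{A,B}[f(q):f(q')]$ if and only if all of $\lceil i_q\rceil\le i_{q'}$, $\lceil j_q\rceil\le j_{q'}$ and $(i_{q'}-i_q)+(j_{q'}-j_q)=1$ hold. Then for any indices $1\le i_\vdash\le i_\dashv\le |A|$ and $1\le j_\vdash\le j_\dashv\le|B|$, a subsequence $Q$ of $R_{A,B}$ is an $[r(i_\vdash,j_\vdash):r(i_\dashv,j_\dashv)]$-banded maximal increasing subsequence of $R_{A,B}[f(i_\vdash,j_\vdash):f(i_\dashv,j_\dashv)]$ if and only if $Q=\hat P$ for some alignment $P$ of $A[i_\vdash:i_\dashv]$ and $B[j_\vdash:j_\dashv]$.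
   Context: Sequences are 1-indexed; for a sequence $S$, $|S|$ is its length, $S[i]$ its $i$-th element, $S[a:b]=S[a]\circ S[a+1]\circ\cdots\circ S[b]$, and $\circ$ denotes concatenation. A subsequence of $S$ is $S[i_1]\circ\cdots\circ S[i_\ell]$ with $\ell\ge1$ and $i_1<\cdots<i_\ell$. A time series is a nonempty finite sequence. For time series $A,B$ and $1\le i\le|A|$, $1\le j\le |B|$, $d_{A,B}(i,j)$ is a nonnegative integer (the dissimilarity of $A[i]$ and $B[j]$). An alignment of $A[i_\vdash:i_\dashv]$ and $B[j_\vdash:j_\dashv]$ is a sequence $P=(i_1,j_1)\circ\cdots\circ(i_{|P|},j_{|P|})$ of index pairs with $(i_1,j_1)=(i_\vdash,j_\vdash)$, $(i_{|P|},j_{|P|})=(i_\dashv,j_\dashv)$, and for each $2\le k\le|P|$, $(i_k,j_k)$ is one of $(i_{k-1}+1,j_{k-1}+1)$, $(i_{k-1}+1,j_{k-1})$, $(i_{k-1},j_{k-1}+1)$. For a sequence $S$ of integers, a subsequence is increasing if each of its elements other than the last is less than the next one; it is $[h_\vdash:h_\dashv]$-banded if all its elements lie between $h_\vdash$ and $h_\dashv$ inclusive. An increasing subsequence $T$ of $S$ is maximal if $T$ is the only increasing subsequence of $S$ that has $T$ as a subsequence. The sequence $R_{A,B}$ has length $|A||B|+(|A|-1)(|B|-1)$ and consists of distinct weighted integers. For $1\le i\le|A|$, $1\le j\le|B|$: $r(i,j)=(j-1)(2|A|-1)+i$, it occurs at position $f(r(i,j))=(i-1)(2|B|-1)+j$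 (i.e. $R_{A,B}[f(r(i,j))]=r(i,j)$), with weight $w(r(i,j))=c-d_{A,B}(i,j)$. For $2\le i\le |A|$, $2\le j\le|B|$: $\tilde r(i,j)=(j-1)(2|A|-1)-i+2$, occurring at position $f(\tilde r(i,j))=(i-1)(2|B|-1)-j+2$, with weight $w(\tilde r(i,j))=c$. These positions are exactly $1,\dots,|R_{A,B}|$. For an element $q$ of $R_{A,B}$, $f(q)$ is its position; $f(i,j)$ abbreviates $f(r(i,j))$. For $q=r(i,j)$ put $i_q=i$, $j_q=j$; for $q=\tilde r(i,j)$ put $i_q=i-0.5$, $j_q=j-0.5$. For an alignment $P$, $\hat P$ is the sequence of elements of $R_{A,B}$ obtained from $P$ by replacing each element $(i_k,j_k)$ with $k\ge2$ and $(i_k,j_k)=(i_{k-1}+1,j_{k-1}+1)$ by $\tilde r(i_k,j_k)\circ r(i_k,j_k)$, and each other element $(i_k,j_k)$ by $r(i_k,j_k)$. -}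

module Defs where

open import Data.Nat using (ℕ; zero; suc; _+_; _*_; _∸_; _≤_; _<_; _⊔_; _≡ᵇ_)
open import Data.Bool using (Bool; true; false; if_then_else_; _∧_)
open import Data.Product using (_×_; _,_; proj₁; proj₂)
open import Data.List using (List; []; _∷_; _++_; map; concatMap; upTo; take; drop; foldr; head; last)
open import Data.List.Relation.Unary.All using (All)
open import Data.List.Relation.Unary.Linked using (Linked)
open import Data.List.Relation.Binary.Sublist.Propositional using (_⊆_)
open import Data.Maybe using (Maybe; just)
open import Relation.Binary.PropositionalEquality using (_≡_; _≢_)
open import Function.Bundles using (_⇔_)

-- Notation: n = |A|, m = |B|, c = max d, d = dissimilarity (1-indexed; values
-- outside 1..n × 1..m are irrelevant).

rv : ℕ → ℕ → ℕ → ℕ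
rv n i j = (j ∸ 1) * (2 * n ∸ 1) + i

-- r~(i,j) = (j-1)(2n-1) - i + 2   (nonnegative for 2 ≤ i ≤ n, 2 ≤ j)
rtv : ℕ → ℕ → ℕ → ℕ
rtv n i j = ((j ∸ 1) * (2 * n ∸ 1) + 2) ∸ i

fpos : ℕ → ℕ → ℕ → ℕ
fpos m i j = (i ∸ 1) * (2 * m ∸ 1) + j

ftpos : ℕ → ℕ → ℕ → ℕ
ftpos m i j = ((i ∸ 1) * (2 * m ∸ 1) + 2) ∸ j

-- Elements of R_{A,B}: either r(i,j) (reg) or r~(i,j) (til)
data Kind : Set where
  reg til : Kind

Elem : Set
Elem = Kind × ℕ × ℕ

Valid : ℕ → ℕ → Elem → Set
Valid n m (reg , i , j) = (1 ≤ i × i ≤ n) × (1 ≤ j × j ≤ m)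
Valid n m (til , i , j) = (2 ≤ i × i ≤ n) × (2 ≤ j × j ≤ m)

value : ℕ → Elem → ℕ
value n (reg , i , j) = rv n i j
value n (til , i , j) = rtv n i j

pos : ℕ → Elem → ℕ
pos m (reg , i , j) = fpos m i j
pos m (til , i , j) = ftpos m i j

-- doubled coordinates: dI q = 2 i_q, dJ q = 2 j_q
dI dJ : Elem → ℕ
dI (reg , i , j) = 2 * i
dI (til , i , j) = 2 * i ∸ 1
dJ (reg , i , j) = 2 * j
dJ (til , i , j) = 2 * j ∸ 1

ceilI ceilJ : Elem → ℕ
ceilI (_ , i , j) = i
ceilJ (_ , i , j) = j

-- weighted integer: (value , weight)
WInt : Set
WInt = ℕ × ℕ

cmax : ℕ → ℕ → (ℕ → ℕ → ℕ) → ℕ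
cmax n m d = foldr _⊔_ 0
  (concatMap (λ i → map (λ j → d i j) (map suc (upTo m))) (map suc (upTo n)))

weight : ℕ → (ℕ → ℕ → ℕ) → Elem → ℕ
weight c d (reg , i , j) = c ∸ d i j
weight c d (til , i , j) = c

elt : ℕ → ℕ → (ℕ → ℕ → ℕ) → Elem → WInt
elt n c d e = value n e , weight c d e

-- Elements of R_{A,B} listed in order of position:
-- row i: r~(i,m), ..., r~(i,2) (only for i ≥ 2), then r(i,1), ..., r(i,m)
tildeRow : ℕ → ℕ → List Elem
tildeRow m zero = []
tildeRow m (suc zero) = []
tildeRow m (suc (suc k)) = map (λ t → til , suc (suc k) , m ∸ t) (upTo (m ∸ 1))

row : ℕ → ℕ → List Elem
row m i = tildeRow m i ++ map (λ t → reg , i , suc t) (upTo m)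

RElems : ℕ → ℕ → List Elem
RElems n m = concatMap (row m) (map suc (upTo n))

Rseq : ℕ → ℕ → ℕ → (ℕ → ℕ → ℕ) → List WInt
Rseq n m c d = map (elt n c d) (RElems n m)

-- S[a:b] (1-indexed, inclusive)
Slice : {X : Set} → List X → ℕ → ℕ → List X
Slice S a b = take (suc b ∸ a) (drop (a ∸ 1) S)

Subseq : List WInt → List WInt → Set
Subseq T S = (T ≢ []) × (T ⊆ S)

_<ʷ_ : WInt → WInt → Set
x <ʷ y = proj₁ x < proj₁ y

Increasing : List WInt → Set
Increasing = Linked _<ʷ_

IncSub : List WInt → List WInt → Set
IncSub T S = Subseq T S × Increasing T

MaxInc : List WInt → List WInt → Set
MaxInc T S = IncSub T S × (∀ T' → IncSub T' S → Subseq T T' → T' ≡ T)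

Banded : ℕ → ℕ → List WInt → Set
Banded lo hi T = All (λ x → lo ≤ proj₁ x × proj₁ x ≤ hi) T

data Step : ℕ × ℕ → ℕ × ℕ → Set where
  diag  : ∀ {i j} → Step (i , j) (suc i , suc j)
  down  : ∀ {i j} → Step (i , j) (suc i , j)
  right : ∀ {i j} → Step (i , j) (i , suc j)

IsAlignment : ℕ → ℕ → ℕ → ℕ → List (ℕ × ℕ) → Set
IsAlignment i⊢ j⊢ i⊣ j⊣ P =
  head P ≡ just (i⊢ , j⊢) × last P ≡ just (i⊣ , j⊣) × Linked Step P

hatTail : ℕ → ℕ → (ℕ → ℕ → ℕ) → ℕ × ℕ → List (ℕ × ℕ) → List WInt
hatTail n c d prev [] = []
hatTail n c d (a , b) ((i , j) ∷ ps) =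
  (if (i ≡ᵇ suc a) ∧ (j ≡ᵇ suc b)
     then elt n c d (til , i , j) ∷ elt n c d (reg , i , j) ∷ []
     else elt n c d (reg , i , j) ∷ [])
  ++ hatTail n c d (i , j) ps

hat : ℕ → ℕ → (ℕ → ℕ → ℕ) → List (ℕ × ℕ) → List WInt
hat n c d [] = []
hat n c d ((i , j) ∷ ps) = elt n c d (reg , i , j) ∷ hatTail n c d (i , j) ps

-- the condition ⌈i_q⌉ ≤ i_q', ⌈j_q⌉ ≤ j_q', (i_q' - i_q) + (j_q' - j_q) = 1 (doubled)
PairCond : Elem → Elem → Set
PairCond q q' = (2 * ceilI q ≤ dI q') × (2 * ceilJ q ≤ dJ q') × (dI q' + dJ q' ≡ dI q + dJ q + 2)

PairHyp : ℕ → ℕ → ℕ → (ℕ → ℕ → ℕ) → Set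
PairHyp n m c d = ∀ q q' → Valid n m q → Valid n m q' → pos m q < pos m q' →
  (MaxInc (elt n c d q ∷ elt n c d q' ∷ []) (Slice (Rseq n m c d) (pos m q) (pos m q'))
    ⇔ PairCond q q')

-- The elements of R_{A,B} are listed by position and have pairwise distinct values.
-- A banded maximal increasing subsequence Q of the window from r(i⊢,j⊢) to r(i⊣,j⊣)
-- must start and end at these two elements, since otherwise they could be added to Q.
-- Maximality is local: Q is maximal iff each pair q ∘ q′ of consecutive elements is a
-- maximal increasing subsequence of R_{A,B}[f(q):f(q′)] (an extension of the pair
-- splices into Q; conversely the pairwise maximal pieces glue together). By hypothesis
-- this says that consecutive elements of Q are related by one of the moves
-- r(i,j) → r(i+1,j), r(i,j) → r(i,j+1), r(i,j) → r~(i+1,j+1) → r(i+1,j+1),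
-- and sequences of such moves are exactly the sequences P̂ of alignments P.

module Submission where

open import Defs
open import Data.Nat
open import Data.Nat.Properties
open import Data.Nat.Tactic.RingSolver using (solve-∀)
open import Data.Bool using (true; false; if_then_else_; _∧_)
open import Data.Product using (_×_; _,_; proj₁; proj₂; ∃; ∃₂)
open import Data.Sum using (_⊎_; inj₁; inj₂)
open import Data.Unit using (⊤; tt)
open import Data.Empty using (⊥-elim)
open import Data.Maybe using (just)
open import Data.Maybe.Properties using (just-injective)
open import Data.List using (List; []; _∷_; _++_; [_]; map; last; take; drop; upTo; applyUpTo; concatMap; initLast; _∷ʳ′_)
import Data.List as List
open import Data.List.Properties using (map-upTo; take++drop≡id; take-map; drop-map; length-++; length-map; length-upTo; ++-assoc; ++-cancelˡ; ∷-injectiveˡ; ∷-injectiveʳ; ++-identityˡ-unique)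
open import Data.List.NonEmpty using (List⁺; length; _∷_)
open import Data.List.Relation.Unary.Any using (here; there)
open import Data.List.Relation.Unary.All as All using (All; []; _∷_)
import Data.List.Relation.Unary.All.Properties as Allₚ
open import Data.List.Relation.Unary.Linked as Linked using (Linked; []; [-]; _∷_)
open import Data.List.Relation.Unary.Linked.Properties as Linkedₚ using (Linked⇒All)
open import Data.List.Relation.Binary.Sublist.Propositional using (_⊆_; []; _∷_; _∷ʳ_; ⊆-refl; ⊆-trans; lookup)
open import Data.List.Relation.Binary.Sublist.Propositional.Properties as Sublistₚ using (++⁺; ++⁺ˡ; ∷⁻; All-resp-⊆; take-⊆; drop-⊆)
open import Data.List.Membership.Propositional using (_∈_; _∉_)
open import Data.List.Membership.Propositional.Properties using (∈-++⁻; ∈-++⁺ˡ; ∈-++⁺ʳ; ∈-∃++; ∈-concat⁻′; ∈-concat⁺′; ∈-map⁺; ∈-map⁻; ∈-upTo⁺; ∈-upTo⁻)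
open import Function using (_∘_; _on_)
open import Function.Bundles using (_⇔_; mk⇔; Equivalence)
open import Relation.Binary.PropositionalEquality hiding ([_])

module _ {A : Set} where

  ⊆-++-split : ∀ (bs : List A) {ds ts} → ts ⊆ bs ++ ds →
    ∃₂ λ u v → ts ≡ u ++ v × u ⊆ bs × v ⊆ ds
  ⊆-++-split [] p = [] , _ , refl , [] , p
  ⊆-++-split (b ∷ bs) (.b ∷ʳ p) with ⊆-++-split bs p
  ... | u , v , refl , pu , pv = u , v , refl , b ∷ʳ pu , pv
  ⊆-++-split (b ∷ bs) (refl ∷ p) with ⊆-++-split bs p
  ... | u , v , refl , pu , pv = b ∷ u , v , refl , refl ∷ pu , pv

  ⊆-around : ∀ (Q₁ : List A) {x Q₂ S} → Q₁ ++ x ∷ Q₂ ⊆ S →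
    ∃₂ λ S₁ S₂ → S ≡ S₁ ++ x ∷ S₂ × Q₁ ⊆ S₁ × Q₂ ⊆ S₂
  ⊆-around [] (y ∷ʳ p) with ⊆-around [] p
  ... | S₁ , S₂ , refl , p₁ , p₂ = y ∷ S₁ , S₂ , refl , y ∷ʳ p₁ , p₂
  ⊆-around [] (refl ∷ p) = [] , _ , refl , [] , p
  ⊆-around (q ∷ Q₁) (y ∷ʳ p) with ⊆-around (q ∷ Q₁) p
  ... | S₁ , S₂ , refl , p₁ , p₂ = y ∷ S₁ , S₂ , refl , y ∷ʳ p₁ , p₂
  ⊆-around (q ∷ Q₁) (refl ∷ p) with ⊆-around Q₁ p
  ... | S₁ , S₂ , refl , p₁ , p₂ = q ∷ S₁ , S₂ , refl , refl ∷ p₁ , p₂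

  ⊆-∷-head : ∀ {x : A} {ts L} → x ∈ ts → ts ⊆ x ∷ L → x ∉ L → ∃ λ t → ts ≡ x ∷ t × t ⊆ L
  ⊆-∷-head x∈ts (_ ∷ʳ p) x∉L = ⊥-elim (x∉L (lookup p x∈ts))
  ⊆-∷-head x∈ts (refl ∷ p) x∉L = _ , refl , p

  ⊆-∷ʳ-last : ∀ {y : A} {ts} (L : List A) → y ∈ ts → ts ⊆ L ++ [ y ] → y ∉ L →
    ∃ λ u → ts ≡ u ++ [ y ] × u ⊆ L
  ⊆-∷ʳ-last [] y∈ts (_ ∷ʳ []) _ with y∈ts
  ... | ()
  ⊆-∷ʳ-last [] (here refl) (refl ∷ []) _ = [] , refl , []
  ⊆-∷ʳ-last (l ∷ L) y∈ts (_ ∷ʳ p) y∉ with ⊆-∷ʳ-last L y∈ts p (y∉ ∘ there)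
  ... | u , e , pu = u , e , l ∷ʳ pu
  ⊆-∷ʳ-last (l ∷ L) (here refl) (refl ∷ p) y∉ = ⊥-elim (y∉ (here refl))
  ⊆-∷ʳ-last (l ∷ L) (there y∈ts) (refl ∷ p) y∉ with ⊆-∷ʳ-last L y∈ts p (y∉ ∘ there)
  ... | u , refl , pu = l ∷ u , refl , refl ∷ pu

  ⊆-∷ʳ⁻ : ∀ {X : List A} (L : List A) {w} → X ⊆ L ++ [ w ] →
    (∃ λ X′ → X ≡ X′ ++ [ w ] × X′ ⊆ L) ⊎ X ⊆ L
  ⊆-∷ʳ⁻ [] (_ ∷ʳ []) = inj₂ []
  ⊆-∷ʳ⁻ [] (refl ∷ []) = inj₁ ([] , refl , [])
  ⊆-∷ʳ⁻ (l ∷ L) (_ ∷ʳ p) with ⊆-∷ʳ⁻ L p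
  ... | inj₁ (X′ , e , q) = inj₁ (X′ , e , l ∷ʳ q)
  ... | inj₂ q = inj₂ (l ∷ʳ q)
  ⊆-∷ʳ⁻ (l ∷ L) (refl ∷ p) with ⊆-∷ʳ⁻ L p
  ... | inj₁ (X′ , refl , q) = inj₁ (l ∷ X′ , refl , refl ∷ q)
  ... | inj₂ q = inj₂ (refl ∷ q)

  last-∷ʳ : ∀ X {z : A} → last (X ++ [ z ]) ≡ just z
  last-∷ʳ [] = refl
  last-∷ʳ (x ∷ []) = refl
  last-∷ʳ (x ∷ y ∷ X) = last-∷ʳ (y ∷ X)

  last⇒∈ : ∀ {z : A} X → last X ≡ just z → z ∈ X
  last⇒∈ (x ∷ []) refl = here refl
  last⇒∈ (x ∷ y ∷ X) eq = there (last⇒∈ (y ∷ X) eq)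

module _ {A : Set} {R : A → A → Set} where

  linked-++⁻ˡ : ∀ (P : List A) {x B} → Linked R (P ++ x ∷ B) → Linked R (P ++ [ x ])
  linked-++⁻ˡ [] _ = [-]
  linked-++⁻ˡ (p ∷ []) (r ∷ _) = r ∷ [-]
  linked-++⁻ˡ (p ∷ q ∷ P) (r ∷ l) = r ∷ linked-++⁻ˡ (q ∷ P) l

  linked-++⁻ʳ : ∀ (P : List A) {B} → Linked R (P ++ B) → Linked R B
  linked-++⁻ʳ [] l = l
  linked-++⁻ʳ (p ∷ P) l = linked-++⁻ʳ P (Linked.tail l)

  linked-join : ∀ (P : List A) {x B} → Linked R (P ++ [ x ]) → Linked R (x ∷ B) → Linked R (P ++ x ∷ B)
  linked-join [] _ l = l
  linked-join (p ∷ []) (r ∷ _) l = r ∷ l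
  linked-join (p ∷ q ∷ P) (r ∷ l₁) l = r ∷ linked-join (q ∷ P) l₁ l

module _ {A : Set} (R : A → A → Set) where

  Maximal : List A → List A → Set
  Maximal Q S = ∀ T → T ⊆ S → Linked R T → Q ⊆ T → T ≡ Q

  maximal-[x] : ∀ x → Maximal [ x ] [ x ]
  maximal-[x] x T (_ ∷ʳ []) _ ()
  maximal-[x] x T (refl ∷ []) _ _ = refl

  -- x and y occur once in the range, so an extension of x ∘ y ∘ Q splits at y into
  -- an extension of x ∘ y and one of y ∘ Q.
  maximal-glue : ∀ {x y : A} Mid S₂ Q →
    x ∉ Mid ++ y ∷ S₂ → y ∉ Mid → y ∉ S₂ →
    Maximal (x ∷ [ y ]) (x ∷ Mid ++ [ y ]) → Maximal (y ∷ Q) (y ∷ S₂) →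
    Maximal (x ∷ y ∷ Q) (x ∷ Mid ++ y ∷ S₂)
  maximal-glue {x} {y} Mid S₂ Q x∉ y∉Mid y∉S₂ max-xy max-yQ T T⊆ lT Q⊆T
    with ⊆-∷-head (lookup Q⊆T (here refl)) T⊆ x∉
  ... | T₁ , refl , T₁⊆ with lookup Q⊆T (there (here refl))
  ... | here x≡y = ⊥-elim (x∉ (subst (_∈ Mid ++ y ∷ S₂) x≡y (∈-++⁺ʳ Mid (here refl))))
  ... | there y∈T₁ with ⊆-++-split Mid T₁⊆
  ... | U , V , refl , U⊆ , V⊆ with ∈-++⁻ U y∈T₁
  ... | inj₁ y∈U = ⊥-elim (y∉Mid (lookup U⊆ y∈U))
  ... | inj₂ y∈V with ⊆-∷-head y∈V V⊆ y∉S₂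
  ... | V′ , refl , V′⊆
    with ++-identityˡ-unique U (sym (∷-injectiveʳ (max-xy (x ∷ U ++ [ y ]) (refl ∷ ++⁺ U⊆ (refl ∷ []))
           (linked-++⁻ˡ (x ∷ U) lT) (refl ∷ ++⁺ˡ U (refl ∷ [])))))
  ... | refl = cong (x ∷_) (max-yQ (y ∷ V′) (refl ∷ V′⊆) (Linked.tail lT) (∷⁻ Q⊆T))

  -- A chain from x to y through Mid can be spliced into the chain Q₁ ∘ x ∘ y ∘ Q₂.
  maximal-pair : ∀ Q₁ {x y} Q₂ S₁ Mid S₂ → x ∉ Mid ++ [ y ] → y ∉ Mid →
    Q₁ ⊆ S₁ → Q₂ ⊆ S₂ → Linked R (Q₁ ++ x ∷ y ∷ Q₂) →
    Maximal (Q₁ ++ x ∷ y ∷ Q₂) (S₁ ++ x ∷ Mid ++ y ∷ S₂) →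
    Maximal (x ∷ [ y ]) (x ∷ Mid ++ [ y ])
  maximal-pair Q₁ {x} {y} Q₂ S₁ Mid S₂ x∉ y∉Mid Q₁⊆ Q₂⊆ lQ maxQ T T⊆ lT xy⊆T
    with ⊆-∷-head (lookup xy⊆T (here refl)) T⊆ x∉
  ... | T₁ , refl , T₁⊆ with lookup xy⊆T (there (here refl))
  ... | here x≡y = ⊥-elim (x∉ (subst (_∈ Mid ++ [ y ]) x≡y (∈-++⁺ʳ Mid (here refl))))
  ... | there y∈T₁ with ⊆-∷ʳ-last Mid y∈T₁ T₁⊆ y∉Mid
  ... | U , refl , U⊆
    with ++-identityˡ-unique U (sym (∷-injectiveʳ (++-cancelˡ Q₁ _ _ (maxQ (Q₁ ++ x ∷ U ++ y ∷ Q₂)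
           (++⁺ Q₁⊆ (refl ∷ ++⁺ U⊆ (refl ∷ Q₂⊆)))
           (linked-join Q₁ (linked-++⁻ˡ Q₁ lQ) (linked-join (x ∷ U) lT (Linked.tail (linked-++⁻ʳ Q₁ lQ))))
           (++⁺ ⊆-refl (refl ∷ ++⁺ˡ U (refl ∷ ⊆-refl)))))))
  ... | refl = refl

module _ {A : Set} (f : A → ℕ) where

  private
    _≺_ : A → A → Set
    _≺_ = _<_ on f

  linked⇒≥head : ∀ {x X} → Linked _≺_ (x ∷ X) → All (λ w → f x ≤ f w) (x ∷ X)
  linked⇒≥head l = Linked⇒All ≤-trans ≤-refl (Linked.map <⇒≤ l)

  linked⇒≤last : ∀ X {z} → Linked _≺_ X → last X ≡ just z → All (λ w → f w ≤ f z) X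
  linked⇒≤last (x ∷ []) _ refl = ≤-refl ∷ []
  linked⇒≤last (x ∷ y ∷ X) (x<y ∷ l) eq with linked⇒≤last (y ∷ X) l eq
  ... | ≤z@(y≤z ∷ _) = ≤-trans (<⇒≤ x<y) y≤z ∷ ≤z

  maximal-starts-at-minimum : ∀ {q₀ S} Q → Q ≢ [] → Q ⊆ q₀ ∷ S → Linked _≺_ Q →
    Maximal _≺_ Q (q₀ ∷ S) → (∀ {w} → w ∈ S → f q₀ ≢ f w) → All (λ w → f q₀ ≤ f w) Q →
    ∃ λ Q′ → Q ≡ q₀ ∷ Q′
  maximal-starts-at-minimum [] Q≢[] _ _ _ _ _ = ⊥-elim (Q≢[] refl)
  maximal-starts-at-minimum (x ∷ Q) _ (refl ∷ _) _ _ _ _ = Q , refl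
  maximal-starts-at-minimum {q₀} (x ∷ Q) _ (_ ∷ʳ Q⊆S) lQ maxQ q₀≢ (q₀≤x ∷ _)
    with ++-identityˡ-unique [ q₀ ] (sym (maxQ (q₀ ∷ x ∷ Q) (refl ∷ Q⊆S)
           (≤∧≢⇒< q₀≤x (q₀≢ (lookup Q⊆S (here refl))) ∷ lQ) (q₀ ∷ʳ ⊆-refl)))
  ... | ()

  maximal-ends-at-maximum : ∀ {qₑ} S Q → Q ≢ [] → Q ⊆ S ++ [ qₑ ] → Linked _≺_ Q →
    Maximal _≺_ Q (S ++ [ qₑ ]) → (∀ {w} → w ∈ S → f w ≢ f qₑ) → All (λ w → f w ≤ f qₑ) Q →
    last Q ≡ just qₑ
  maximal-ends-at-maximum S Q Q≢[] Q⊆ lQ maxQ ≢qₑ ≤qₑ with ⊆-∷ʳ⁻ S Q⊆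
  ... | inj₁ (Q′ , refl , _) = last-∷ʳ Q′
  ... | inj₂ Q⊆S with initLast Q
  ...   | [] = ⊥-elim (Q≢[] refl)
  ...   | Qᵢ ∷ʳ′ z with ∷-injectiveʳ (++-cancelˡ Qᵢ _ _ (maxQ (Qᵢ ++ z ∷ [ _ ])
            (subst (_⊆ S ++ [ _ ]) (++-assoc Qᵢ [ z ] [ _ ]) (++⁺ Q⊆S (refl ∷ [])))
            (linked-join Qᵢ lQ (z<qₑ ∷ [-]))
            (++⁺ (⊆-refl {x = Qᵢ}) (refl ∷ (_ ∷ʳ [])))))
    where
    z∈ : z ∈ Qᵢ ++ [ z ]
    z∈ = ∈-++⁺ʳ Qᵢ (here refl)
    z<qₑ : f z < f _
    z<qₑ = ≤∧≢⇒< (All.lookup ≤qₑ z∈) (≢qₑ (lookup Q⊆S z∈))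
  ...     | ()

module _ {X : Set} where

  take-length-++ : ∀ (U V : List X) → take (List.length U) (U ++ V) ≡ U
  take-length-++ [] V = refl
  take-length-++ (u ∷ U) V = cong (u ∷_) (take-length-++ U V)

  drop-length-++ : ∀ (U V : List X) → drop (List.length U) (U ++ V) ≡ V
  drop-length-++ [] V = refl
  drop-length-++ (u ∷ U) V = drop-length-++ U V

  Slice-++ : ∀ (B S C : List X) → Slice (B ++ S ++ C) (suc (List.length B)) (List.length B + List.length S) ≡ S
  Slice-++ B S C rewrite m+n∸m≡n (List.length B) (List.length S) | drop-length-++ B (S ++ C) = take-length-++ S C

  Slice-infix : ∀ (L : List X) a b → ∃₂ λ B C → L ≡ B ++ Slice L a b ++ C
  Slice-infix L a b =
    take (a ∸ 1) L , drop (suc b ∸ a) (drop (a ∸ 1) L) ,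
    sym (trans (cong (take (a ∸ 1) L ++_) (take++drop≡id (suc b ∸ a) (drop (a ∸ 1) L))) (take++drop≡id (a ∸ 1) L))

  Slice-map : ∀ {Y : Set} (f : X → Y) (L : List X) a b → Slice (map f L) a b ≡ map f (Slice L a b)
  Slice-map f L a b = trans (cong (take (suc b ∸ a)) (drop-map (a ∸ 1) L)) (take-map (suc b ∸ a) (drop (a ∸ 1) L))

module Positions {A : Set} (p : A → ℕ) where

  Consecutive : ℕ → List A → Set
  Consecutive s [] = ⊤
  Consecutive s (e ∷ L) = p e ≡ s × Consecutive (suc s) L

  consecutive-++⁺ : ∀ {s} (L L′ : List A) →
    Consecutive s L → Consecutive (s + List.length L) L′ → Consecutive s (L ++ L′)
  consecutive-++⁺ {s} [] L′ _ c′ = subst (λ t → Consecutive t L′) (+-identityʳ s) c′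
  consecutive-++⁺ {s} (e ∷ L) L′ (pe , c) c′ =
    pe , consecutive-++⁺ L L′ c (subst (λ t → Consecutive t L′) (+-suc s (List.length L)) c′)

  consecutive-++⁻ : ∀ {s} (L : List A) {L′} →
    Consecutive s (L ++ L′) → Consecutive s L × Consecutive (s + List.length L) L′
  consecutive-++⁻ {s} [] {L′} c = tt , subst (λ t → Consecutive t L′) (sym (+-identityʳ s)) c
  consecutive-++⁻ {s} (e ∷ L) {L′} (pe , c) with consecutive-++⁻ L c
  ... | c₁ , c₂ = (pe , c₁) , subst (λ t → Consecutive t L′) (sym (+-suc s (List.length L))) c₂

  consecutive-upTo : ∀ {s} (g : ℕ → A) k →
    (∀ t → t < k → p (g t) ≡ s + t) → Consecutive s (map g (upTo k))
  consecutive-upTo {s} g k at = subst (Consecutive s) (sym (map-upTo g k)) (applyUpTo⁺ g k at)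
    where
    applyUpTo⁺ : ∀ {s} (g : ℕ → A) k → (∀ t → t < k → p (g t) ≡ s + t) → Consecutive s (applyUpTo g k)
    applyUpTo⁺ g zero _ = tt
    applyUpTo⁺ {s} g (suc k) at =
      trans (at 0 z<s) (+-identityʳ s) ,
      applyUpTo⁺ (g ∘ suc) k (λ t t<k → trans (at (suc t) (s<s t<k)) (+-suc s t))

  consecutive-pos : ∀ {s} (L : List A) {x L′} → Consecutive s (L ++ x ∷ L′) → p x ≡ s + List.length L
  consecutive-pos L c = proj₁ (proj₂ (consecutive-++⁻ L c))

  consecutive-bounds : ∀ {s} L {w} → Consecutive s L → w ∈ L → s ≤ p w × p w < s + List.length L
  consecutive-bounds {s} (e ∷ L) (pe , c) (here refl) =
    ≤-reflexive (sym pe) , subst (_< s + suc (List.length L)) (sym pe) (m<m+n s z<s)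
  consecutive-bounds {s} (e ∷ L) {w} (_ , c) (there w∈) with consecutive-bounds L c w∈
  ... | lo , hi = ≤-trans (n≤1+n s) lo , subst (p w <_) (sym (+-suc s (List.length L))) hi

  consecutive-∉ : ∀ {s} L {x L′} → Consecutive s (L ++ x ∷ L′) → x ∉ L × x ∉ L′
  consecutive-∉ L c with consecutive-++⁻ L c
  ... | c₁ , (px , c₂) =
    (λ x∈L → <-irrefl px (proj₂ (consecutive-bounds L c₁ x∈L))) ,
    (λ x∈L′ → <-irrefl refl (≤-trans (s≤s (≤-reflexive px)) (proj₁ (consecutive-bounds _ c₂ x∈L′))))

  module _ {L : List A} (cL : Consecutive 1 L) where

    consecutive-< : ∀ B {x} M {y C} → L ≡ B ++ x ∷ M ++ y ∷ C → p x < p y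
    consecutive-< B {x} M {y} {C} refl = begin-strict
      p x                          ≡⟨ consecutive-pos B cL ⟩
      suc (List.length B)               <⟨ s≤s (m<m+n (List.length B) z<s) ⟩
      suc (List.length B + suc (List.length M)) ≡⟨ cong suc (sym (length-++ B)) ⟩
      suc (List.length (B ++ x ∷ M))    ≡⟨ sym (consecutive-pos (B ++ x ∷ M) (subst (Consecutive 1) (sym (++-assoc B (x ∷ M) (y ∷ C))) cL)) ⟩
      p y                          ∎
      where open ≤-Reasoning

    infix-∉ : ∀ {S B C} U {x} V → L ≡ B ++ S ++ C → S ≡ U ++ x ∷ V → x ∉ U × x ∉ V
    infix-∉ {S} {B} {C} U {x} V refl refl
      with consecutive-∉ (B ++ U) (subst (Consecutive 1) (reassoc B U (x ∷ V) C) cL)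
      where
      reassoc : ∀ (B U V C : List A) → B ++ (U ++ V) ++ C ≡ (B ++ U) ++ V ++ C
      reassoc B U V C = trans (cong (B ++_) (++-assoc U V C)) (sym (++-assoc B U (V ++ C)))
    ... | ∉BU , ∉VC = ∉BU ∘ ∈-++⁺ʳ B , ∉VC ∘ ∈-++⁺ˡ

    slice-infix : ∀ {B C x} M {z} M₀ → L ≡ B ++ (x ∷ M) ++ C → x ∷ M ≡ M₀ ++ [ z ] →
      Slice L (p x) (p z) ≡ x ∷ M
    slice-infix {B} {C} {x} M {z} M₀ eL eM = begin
      Slice L (p x) (p z)                                        ≡⟨ cong₂ (Slice L) px pz ⟩
      Slice L (suc (List.length B)) (List.length B + List.length (x ∷ M))       ≡⟨ cong (λ t → Slice t (suc (List.length B)) (List.length B + List.length (x ∷ M))) eL ⟩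
      Slice (B ++ (x ∷ M) ++ C) (suc (List.length B)) (List.length B + List.length (x ∷ M)) ≡⟨ Slice-++ B (x ∷ M) C ⟩
      x ∷ M                                                      ∎
      where
      open ≡-Reasoning
      px : p x ≡ suc (List.length B)
      px = consecutive-pos B (subst (Consecutive 1) eL cL)
      eL₀ : L ≡ (B ++ M₀) ++ z ∷ C
      eL₀ = trans eL (trans (cong (λ S → B ++ S ++ C) eM)
              (trans (cong (B ++_) (++-assoc M₀ [ z ] C)) (sym (++-assoc B M₀ (z ∷ C)))))
      pz : p z ≡ List.length B + List.length (x ∷ M)
      pz = begin
        p z                             ≡⟨ consecutive-pos (B ++ M₀) (subst (Consecutive 1) eL₀ cL) ⟩
        suc (List.length (B ++ M₀))          ≡⟨ cong suc (length-++ B) ⟩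
        suc (List.length B + List.length M₀)      ≡⟨ sym (+-suc (List.length B) (List.length M₀)) ⟩
        List.length B + suc (List.length M₀)      ≡⟨ cong (List.length B +_) (+-comm 1 (List.length M₀)) ⟩
        List.length B + (List.length M₀ + 1)      ≡⟨ cong (List.length B +_) (sym (length-++ M₀)) ⟩
        List.length B + List.length (M₀ ++ [ z ]) ≡⟨ cong (λ S → List.length B + List.length S) (sym eM) ⟩
        List.length B + List.length (x ∷ M)       ∎

    locate-after : ∀ B {y} C {z} → L ≡ B ++ y ∷ C → z ∈ L → p y ≤ p z → z ≡ y ⊎ ∃₂ λ D F → C ≡ D ++ z ∷ F
    locate-after B C refl z∈L py≤pz with ∈-++⁻ B z∈L
    ... | inj₁ z∈B = ⊥-elim (<⇒≱ (≤-<-trans py≤pz (proj₂ (consecutive-bounds B (proj₁ (consecutive-++⁻ B cL)) z∈B)))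
                                 (≤-reflexive (sym (consecutive-pos B cL))))
    ... | inj₂ (here refl) = inj₁ refl
    ... | inj₂ (there z∈C) = inj₂ (∈-∃++ z∈C)

    segment : ∀ {x z} → x ∈ L → z ∈ L → p x ≤ p z →
      ∃₂ λ B C → ∃₂ λ M M₀ → L ≡ B ++ (x ∷ M) ++ C × x ∷ M ≡ M₀ ++ [ z ]
    segment {x} x∈L z∈L px≤pz with ∈-∃++ x∈L
    ... | B , C , eL with locate-after B C eL z∈L px≤pz
    ...   | inj₁ refl = B , C , [] , [] , eL , refl
    ...   | inj₂ (D , F , refl) =
      B , F , D ++ [ _ ] , x ∷ D , trans eL (cong (λ S → B ++ x ∷ S) (sym (++-assoc D [ _ ] F))) , refl

    slice-∉ : ∀ a b U {x} V → Slice L a b ≡ U ++ x ∷ V → x ∉ U × x ∉ V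
    slice-∉ a b U V eq with Slice-infix L a b
    ... | B , C , eL = infix-∉ {B = B} {C} U V eL eq

    slice-point : ∀ {x} → x ∈ L → Slice L (p x) (p x) ≡ [ x ]
    slice-point x∈L with ∈-∃++ x∈L
    ... | B , C , eL = slice-infix {B} {C} [] [] eL refl

    slice-split : ∀ {x y z} → x ∈ L → y ∈ L → z ∈ L → p x < p y → p y ≤ p z →
      ∃₂ λ Mid S₂ → Slice L (p x) (p y) ≡ x ∷ Mid ++ [ y ] × Slice L (p y) (p z) ≡ y ∷ S₂ ×
                    Slice L (p x) (p z) ≡ x ∷ Mid ++ y ∷ S₂
    slice-split {x} {y} {z} x∈L y∈L z∈L px<py py≤pz with ∈-∃++ x∈L
    ... | B , F , eL with locate-after B F eL y∈L (<⇒≤ px<py)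
    ...   | inj₁ refl = ⊥-elim (<-irrefl refl px<py)
    ...   | inj₂ (Mid , G , refl) with locate-after (B ++ x ∷ Mid) G (trans eL (sym (++-assoc B (x ∷ Mid) (y ∷ G)))) z∈L py≤pz
    ...     | inj₁ refl = Mid , [] , sxy , syy , sxy
      where
      sxy : Slice L (p x) (p y) ≡ x ∷ Mid ++ [ y ]
      sxy = slice-infix (Mid ++ [ y ]) (x ∷ Mid) (trans eL (cong (λ t → B ++ x ∷ t) (sym (++-assoc Mid [ y ] G)))) refl
      syy : Slice L (p y) (p y) ≡ [ y ]
      syy = slice-infix [] [] (trans eL (sym (++-assoc B (x ∷ Mid) (y ∷ G)))) refl
    ...     | inj₂ (D , H , refl) = Mid , D ++ [ z ] , sxy , syz , sxz
      where
      sxy : Slice L (p x) (p y) ≡ x ∷ Mid ++ [ y ]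
      sxy = slice-infix (Mid ++ [ y ]) (x ∷ Mid) (trans eL (cong (λ t → B ++ x ∷ t) (sym (++-assoc Mid [ y ] (D ++ z ∷ H))))) refl
      syz : Slice L (p y) (p z) ≡ y ∷ D ++ [ z ]
      syz = slice-infix (D ++ [ z ]) (y ∷ D)
              (trans eL (trans (sym (++-assoc B (x ∷ Mid) (y ∷ D ++ z ∷ H)))
                (cong (λ t → (B ++ x ∷ Mid) ++ y ∷ t) (sym (++-assoc D [ z ] H))))) refl
      sxz : Slice L (p x) (p z) ≡ x ∷ Mid ++ y ∷ D ++ [ z ]
      sxz = slice-infix (Mid ++ y ∷ D ++ [ z ]) (x ∷ Mid ++ y ∷ D)
              (trans eL (cong (λ t → B ++ x ∷ t) (trans (cong (λ u → Mid ++ y ∷ u) (sym (++-assoc D [ z ] H)))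
                (sym (++-assoc Mid (y ∷ D ++ [ z ]) H)))))
              (cong (x ∷_) (sym (++-assoc Mid (y ∷ D) [ z ])))

module _ {A B : Set} {P : A → Set} (f : A → B) (f-injective : ∀ {x y} → P x → P y → f x ≡ f y → x ≡ y) where

  map-⊆-lift : ∀ {T} Y → T ⊆ map f Y → ∃ λ X → T ≡ map f X × X ⊆ Y
  map-⊆-lift [] [] = [] , refl , []
  map-⊆-lift (y ∷ Y) (_ ∷ʳ T⊆) with map-⊆-lift Y T⊆
  ... | X , refl , X⊆ = X , refl , y ∷ʳ X⊆
  map-⊆-lift (y ∷ Y) (refl ∷ T⊆) with map-⊆-lift Y T⊆
  ... | X , refl , X⊆ = y ∷ X , refl , refl ∷ X⊆

  map-⊆-reflect : ∀ {X Y} → All P X → All P Y → map f X ⊆ map f Y → X ⊆ Y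
  map-⊆-reflect {[]} {[]} _ _ [] = []
  map-⊆-reflect {X} {y ∷ Y} PX (_ ∷ PY) (_ ∷ʳ X⊆) = y ∷ʳ map-⊆-reflect PX PY X⊆
  map-⊆-reflect {x ∷ X} {y ∷ Y} (Px ∷ PX) (Py ∷ PY) (fx≡fy ∷ X⊆) =
    f-injective Px Py fx≡fy ∷ map-⊆-reflect PX PY X⊆

  map-injective : ∀ {X Y} → All P X → All P Y → map f X ≡ map f Y → X ≡ Y
  map-injective {[]} {[]} _ _ _ = refl
  map-injective {x ∷ X} {y ∷ Y} (Px ∷ PX) (Py ∷ PY) eq =
    cong₂ _∷_ (f-injective Px Py (∷-injectiveˡ eq)) (map-injective PX PY (∷-injectiveʳ eq))

  module _ {R : B → B → Set} {Q S : List A} (PS : All P S) (Q⊆S : Q ⊆ S) where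

    maximal-map⁺ : Maximal (R on f) Q S → Maximal R (map f Q) (map f S)
    maximal-map⁺ maxQ T T⊆ lT fQ⊆T with map-⊆-lift S T⊆
    ... | X , refl , X⊆S =
      cong (map f) (maxQ X X⊆S (Linkedₚ.map⁻ lT) (map-⊆-reflect (All-resp-⊆ Q⊆S PS) (All-resp-⊆ X⊆S PS) fQ⊆T))

    maximal-map⁻ : Maximal R (map f Q) (map f S) → Maximal (R on f) Q S
    maximal-map⁻ maxQ T T⊆ lT Q⊆T =
      map-injective (All-resp-⊆ T⊆ PS) (All-resp-⊆ Q⊆S PS)
        (maxQ (map f T) (Sublistₚ.map⁺ f T⊆) (Linkedₚ.map⁺ lT) (Sublistₚ.map⁺ f Q⊆T))

length-map-upTo : ∀ {A : Set} (g : ℕ → A) k → List.length (map g (upTo k)) ≡ k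
length-map-upTo g k = trans (length-map g (upTo k)) (length-upTo k)

2m∸1≡m′+m : ∀ m′ → 2 * suc m′ ∸ 1 ≡ m′ + suc m′
2m∸1≡m′+m m′ = cong (m′ +_) (+-identityʳ (suc m′))

-- Row 1 of R_{A,B} holds m elements and every later row K = 2m - 1, so row r + 2
-- starts at position r K + m + 1.
module RowLayout (m′ : ℕ) where
  private
    m K : ℕ
    m = suc m′
    K = 2 * m ∸ 1
  open Positions (pos m)

  row₁-consecutive : Consecutive 1 (row m 1)
  row₁-consecutive = consecutive-upTo (λ t → reg , 1 , suc t) m (λ t _ → refl)

  length-row₁ : List.length (row m 1) ≡ m
  length-row₁ = length-map-upTo (λ t → reg , 1 , suc t) m

  length-row₂₊ : ∀ r → List.length (row m (2 + r)) ≡ K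
  length-row₂₊ r = begin
    List.length (row m (2 + r))                                  ≡⟨ length-++ (tildeRow m (2 + r)) ⟩
    List.length (tildeRow m (2 + r)) + List.length (map regular (upTo m)) ≡⟨ cong₂ _+_ (length-map-upTo _ m′) (length-map-upTo _ m) ⟩
    m′ + m                                                  ≡⟨ sym (2m∸1≡m′+m m′) ⟩
    K                                                       ∎
    where
    open ≡-Reasoning
    regular : ℕ → Elem
    regular t = reg , 2 + r , suc t

  row₂₊-consecutive : ∀ r → Consecutive (suc (r * K + m)) (row m (2 + r))
  row₂₊-consecutive r =
    consecutive-++⁺ (tildeRow m (2 + r)) _
      (consecutive-upTo tilde m′ (λ t t<m′ → tilde-pos t (≤-trans (<⇒≤ t<m′) (n≤1+n m′))))
      (subst (λ z → Consecutive (s₀ + z) (map regular (upTo m))) (sym (length-map-upTo tilde m′))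
        (consecutive-upTo regular m (λ t _ → regular-pos t)))
    where
    s₀ : ℕ
    s₀ = suc (r * K + m)
    tilde regular : ℕ → Elem
    tilde t = til , 2 + r , m ∸ t
    regular t = reg , 2 + r , suc t
    open ≡-Reasoning
    tilde-pos : ∀ t → t ≤ m → ((suc r) * K + 2) ∸ (m ∸ t) ≡ s₀ + t
    tilde-pos t t≤m = begin
      (suc r * K + 2) ∸ (m ∸ t)            ≡⟨ cong (λ k → (suc r * k + 2) ∸ (m ∸ t)) (2m∸1≡m′+m m′) ⟩
      (suc r * (m′ + m) + 2) ∸ (m ∸ t)     ≡⟨ cong (_∸ (m ∸ t)) (shift r m′) ⟩
      (suc (r * (m′ + m) + m) + m) ∸ (m ∸ t) ≡⟨ +-∸-assoc _ (m∸n≤m m t) ⟩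
      suc (r * (m′ + m) + m) + (m ∸ (m ∸ t)) ≡⟨ cong₂ (λ k u → suc (r * k + m) + u) (sym (2m∸1≡m′+m m′)) (m∸[m∸n]≡n t≤m) ⟩
      s₀ + t                                ∎
      where
      shift : ∀ r m′ → suc r * (m′ + suc m′) + 2 ≡ suc (r * (m′ + suc m′) + suc m′) + suc m′
      shift = solve-∀
    regular-pos : ∀ t → suc r * K + suc t ≡ s₀ + m′ + t
    regular-pos t rewrite 2m∸1≡m′+m m′ = shift r m′ t
      where
      shift : ∀ r m′ t → suc r * (m′ + suc m′) + suc t ≡ suc (r * (m′ + suc m′) + suc m′) + m′ + t
      shift = solve-∀

  rows₂₊-consecutive : ∀ k r (g : ℕ → ℕ) → (∀ t → g t ≡ 2 + (r + t)) →
    Consecutive (suc (r * K + m)) (concatMap (row m) (applyUpTo g k))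
  rows₂₊-consecutive zero r g _ = tt
  rows₂₊-consecutive (suc k) r g g≗ rewrite g≗ 0 | +-identityʳ r =
    consecutive-++⁺ (row m (2 + r)) _ (row₂₊-consecutive r)
      (subst (λ z → Consecutive z (concatMap (row m) (applyUpTo (g ∘ suc) k))) next-start
        (rows₂₊-consecutive k (suc r) (g ∘ suc) (λ t → trans (g≗ (suc t)) (cong (2 +_) (+-suc r t)))))
    where
    next-start : suc (suc r * K + m) ≡ suc (r * K + m) + List.length (row m (2 + r))
    next-start rewrite length-row₂₊ r = cong suc (shift (r * K) K m)
      where
      shift : ∀ x k m → k + x + m ≡ x + m + k
      shift = solve-∀

RElems-consecutive : ∀ n′ m′ → Positions.Consecutive (pos (suc m′)) 1 (RElems (suc n′) (suc m′))
RElems-consecutive n′ m′ =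
  subst (λ rs → Consecutive 1 (concatMap (row (suc m′)) rs)) (sym (map-upTo suc (suc n′)))
    (consecutive-++⁺ (row (suc m′) 1) (concatMap (row (suc m′)) (applyUpTo (suc ∘ suc) n′)) row₁-consecutive
      (subst (λ z → Consecutive (suc z) (concatMap (row (suc m′)) (applyUpTo (suc ∘ suc) n′)))
        (sym length-row₁)
        (rows₂₊-consecutive n′ 0 (suc ∘ suc) (λ _ → refl))))
  where
  open RowLayout m′
  open Positions (pos (suc m′))

∈-row⇒Valid : ∀ {n m i x} → 1 ≤ i → i ≤ n → x ∈ row m i → Valid n m x
∈-row⇒Valid {n} {m} {i} 1≤i i≤n x∈ with ∈-++⁻ (tildeRow m i) x∈
... | inj₂ x∈regular with ∈-map⁻ (λ t → reg , i , suc t) x∈regular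
...   | t , t∈ , refl = (1≤i , i≤n) , (s≤s z≤n , ∈-upTo⁻ t∈)
∈-row⇒Valid {n} {m} {suc (suc k)} _ i≤n x∈ | inj₁ x∈tilde
  with ∈-map⁻ (λ t → til , suc (suc k) , m ∸ t) x∈tilde
... | t , t∈ , refl = (s≤s (s≤s z≤n) , i≤n) , (2≤m∸t m t (∈-upTo⁻ t∈) , m∸n≤m m t)
  where
  2≤m∸t : ∀ m t → suc t ≤ m ∸ 1 → 2 ≤ m ∸ t
  2≤m∸t (suc (suc m)) zero _ = s≤s (s≤s z≤n)
  2≤m∸t (suc (suc m)) (suc t) (s≤s lt) = 2≤m∸t (suc m) t lt

∈RElems⇒Valid : ∀ {n m x} → x ∈ RElems n m → Valid n m x
∈RElems⇒Valid {n} {m} x∈ with ∈-concat⁻′ (map (row m) (map suc (upTo n))) x∈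
... | xs , x∈xs , xs∈ with ∈-map⁻ (row m) xs∈
...   | i , i∈ , refl with ∈-map⁻ suc i∈
...     | t , t∈ , refl = ∈-row⇒Valid (s≤s z≤n) (∈-upTo⁻ t∈) x∈xs

Valid⇒∈RElems : ∀ {n m} q → Valid n m q → q ∈ RElems n m
Valid⇒∈RElems {n} {m} (reg , suc i , suc j) ((_ , i≤n) , (_ , j≤m)) =
  ∈-concat⁺′ (∈-++⁺ʳ (tildeRow m (suc i)) (∈-map⁺ (λ t → reg , suc i , suc t) (∈-upTo⁺ j≤m)))
             (∈-map⁺ (row m) (∈-map⁺ suc (∈-upTo⁺ i≤n)))
Valid⇒∈RElems {n} {suc m} (til , suc (suc i) , suc (suc j)) ((_ , i≤n) , (_ , j≤m)) =
  ∈-concat⁺′ (∈-++⁺ˡ x∈tilde) (∈-map⁺ (row (suc m)) (∈-map⁺ suc (∈-upTo⁺ i≤n)))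
  where
  t<m : ∀ m j → suc (suc j) ≤ suc m → m ∸ suc j < m
  t<m zero j (s≤s ())
  t<m (suc m) j _ = s≤s (m∸n≤m m j)
  x∈tilde : (til , suc (suc i) , suc (suc j)) ∈ tildeRow (suc m) (suc (suc i))
  x∈tilde = subst (λ z → (til , suc (suc i) , z) ∈ tildeRow (suc m) (suc (suc i))) (m∸[m∸n]≡n j≤m)
              (∈-map⁺ (λ t → til , suc (suc i) , suc m ∸ t) (∈-upTo⁺ (t<m m j j≤m)))
Valid⇒∈RElems (reg , zero , _) ((() , _) , _)
Valid⇒∈RElems (reg , suc _ , zero) (_ , (() , _))
Valid⇒∈RElems (til , zero , _) ((() , _) , _)
Valid⇒∈RElems (til , suc zero , _) ((s≤s () , _) , _)
Valid⇒∈RElems (til , suc (suc _) , zero) (_ , (() , _))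
Valid⇒∈RElems (til , suc (suc _) , suc zero) (_ , (s≤s () , _))
Valid⇒∈RElems {m = zero} (til , suc (suc _) , suc (suc _)) (_ , (_ , ()))

*+-injective : ∀ K {a b r r′} → 1 ≤ r → r ≤ K → 1 ≤ r′ → r′ ≤ K →
  a * K + r ≡ b * K + r′ → a ≡ b × r ≡ r′
*+-injective K {zero} {zero} _ _ _ _ eq = refl , eq
*+-injective K {zero} {suc b} {r} 1≤r r≤K 1≤r′ _ eq = ⊥-elim (<⇒≱ (s≤s r≤K) (begin
  1 + K            ≡⟨ +-comm 1 K ⟩
  K + 1            ≤⟨ +-mono-≤ (m≤m+n K (b * K)) 1≤r′ ⟩
  suc b * K + _    ≡⟨ sym eq ⟩
  r                ∎))
  where open ≤-Reasoning
*+-injective K {suc a} {zero} {r′ = r′} 1≤r _ _ r′≤K eq = ⊥-elim (<⇒≱ (s≤s r′≤K) (begin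
  1 + K            ≡⟨ +-comm 1 K ⟩
  K + 1            ≤⟨ +-mono-≤ (m≤m+n K (a * K)) 1≤r ⟩
  suc a * K + _    ≡⟨ eq ⟩
  r′               ∎))
  where open ≤-Reasoning
*+-injective K {suc a} {suc b} {r} {r′} h₁ h₂ h₃ h₄ eq
  with *+-injective K {a} {b} h₁ h₂ h₃ h₄
         (+-cancelˡ-≡ K _ _ (trans (sym (+-assoc K (a * K) r)) (trans eq (+-assoc K (b * K) r′))))
... | refl , r≡r′ = refl , r≡r′

module _ (n′ : ℕ) where
  private
    n K : ℕ
    n = suc n′
    K = 2 * n ∸ 1

  -- r(i,j) = (j-1) K + i and r~(i,j) = (j-2) K + (K - i + 2): a block and a digit in
  -- [1, K], where the digit is at most n for r and exceeds n for r~.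
  block digit : Elem → ℕ
  block (reg , i , j) = j ∸ 1
  block (til , i , j) = j ∸ 2
  digit (reg , i , j) = i
  digit (til , i , j) = K ∸ (i ∸ 2)

  private
    n≤K : n ≤ K
    n≤K = subst (n ≤_) (sym (2m∸1≡m′+m n′)) (m≤n+m n n′)

  value≡block*K+digit : ∀ {m} q → Valid n m q → value n q ≡ block q * K + digit q
  value≡block*K+digit (reg , i , j) _ = refl
  value≡block*K+digit (til , suc (suc i) , suc (suc j)) ((_ , i≤n) , _) = begin
    (suc j * K + 2) ∸ (2 + i)  ≡⟨ cong (_∸ (2 + i)) (+-comm (suc j * K) 2) ⟩
    (K + j * K) ∸ i            ≡⟨ cong (_∸ i) (+-comm K (j * K)) ⟩
    (j * K + K) ∸ i            ≡⟨ +-∸-assoc (j * K) (≤-trans (m≤n+m i 2) (≤-trans i≤n n≤K)) ⟩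
    j * K + (K ∸ i)            ∎
    where open ≡-Reasoning
  value≡block*K+digit (til , suc zero , _) ((s≤s () , _) , _)
  value≡block*K+digit (til , suc (suc _) , suc zero) (_ , (s≤s () , _))

  digit-bounds : ∀ {m} q → Valid n m q → 1 ≤ digit q × digit q ≤ K
  digit-regular : ∀ {m i j} → Valid n m (reg , i , j) → digit (reg , i , j) ≤ n
  digit-tilde : ∀ {m i j} → Valid n m (til , i , j) → n < digit (til , i , j)
  digit-regular ((_ , i≤n) , _) = i≤n
  digit-tilde {i = suc (suc i)} ((_ , s≤s i<n) , _) =
    m+n≤o⇒m≤o∸n (suc n) (subst (suc (n + i) ≤_) (trans (+-comm n n′) (sym (2m∸1≡m′+m n′)))
      (subst (_≤ n + n′) (+-suc n i) (+-monoʳ-≤ n i<n)))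
  digit-tilde {i = suc zero} ((s≤s () , _) , _)
  digit-bounds (reg , i , j) v@((1≤i , _) , _) = 1≤i , ≤-trans (digit-regular v) n≤K
  digit-bounds (til , i , j) v = ≤-trans (s≤s z≤n) (digit-tilde v) , m∸n≤m K (i ∸ 2)

  block-digit-injective : ∀ {m} q q′ → Valid n m q → Valid n m q′ →
    block q ≡ block q′ → digit q ≡ digit q′ → q ≡ q′
  block-digit-injective (reg , i , j) (reg , i′ , j′) (_ , (1≤j , _)) (_ , (1≤j′ , _)) eb refl
    with ∸-cancelʳ-≡ 1≤j 1≤j′ eb
  ... | refl = refl
  block-digit-injective (til , suc (suc i) , j) (til , suc (suc i′) , j′)
    ((_ , i≤n) , (2≤j , _)) ((_ , i′≤n) , (2≤j′ , _)) eb ed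
    with ∸-cancelʳ-≡ 2≤j 2≤j′ eb
       | ∸-cancelˡ-≡ (≤-trans (m≤n+m i 2) (≤-trans i≤n n≤K)) (≤-trans (m≤n+m i′ 2) (≤-trans i′≤n n≤K)) ed
  ... | refl | refl = refl
  block-digit-injective (til , suc zero , _) _ ((s≤s () , _) , _) _ _ _
  block-digit-injective _ (til , suc zero , _) _ ((s≤s () , _) , _) _ _
  block-digit-injective (reg , i , j) (til , i′ , j′) v v′ _ eq =
    ⊥-elim (<⇒≱ (digit-tilde v′) (subst (_≤ n) eq (digit-regular v)))
  block-digit-injective (til , i , j) (reg , i′ , j′) v v′ _ eq =
    ⊥-elim (<⇒≱ (digit-tilde v) (subst (_≤ n) (sym eq) (digit-regular v′)))

  value-injective : ∀ {m} q q′ → Valid n m q → Valid n m q′ → value n q ≡ value n q′ → q ≡ q′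
  value-injective q q′ v v′ eq with digit-bounds q v | digit-bounds q′ v′
  ... | lo , hi | lo′ , hi′
    with *+-injective K {block q} {block q′} lo hi lo′ hi′
           (trans (sym (value≡block*K+digit q v)) (trans eq (value≡block*K+digit q′ v′)))
  ... | eb , ed = block-digit-injective q q′ v v′ eb ed

-- The links between consecutive elements of P̂: a vertical or horizontal step of P
-- contributes r(i,j), a diagonal step r~(i,j) ∘ r(i,j).
data Move : Elem → Elem → Set where
  down  : ∀ {i j} → Move (reg , i , j) (reg , suc i , j)
  right : ∀ {i j} → Move (reg , i , j) (reg , i , suc j)
  enter : ∀ {i j} → Move (reg , i , j) (til , suc i , suc j)
  leave : ∀ {i j} → Move (til , i , j) (reg , i , j)

private
  2*suc∸1 : ∀ k → 2 * suc k ∸ 1 ≡ suc (2 * k)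
  2*suc∸1 k = +-suc k (k + 0)

  squeeze : ∀ {x y a b} → a ≤ x → b ≤ y → x + y ≡ a + b → x ≡ a × y ≡ b
  squeeze {x} {y} {a} {b} a≤x b≤y eq =
    ≤-antisym (+-cancelʳ-≤ b x a (≤-trans (+-monoʳ-≤ x b≤y) (≤-reflexive eq))) a≤x ,
    ≤-antisym (+-cancelˡ-≤ a y b (≤-trans (+-monoˡ-≤ y a≤x) (≤-reflexive eq))) b≤y

  unit-step : ∀ {i j a b} → a ≤ i → b ≤ j → i + j ≡ suc (a + b) → (i ≡ suc a × j ≡ b) ⊎ (i ≡ a × j ≡ suc b)
  unit-step {i} {j} {a} {b} a≤i b≤j eq with m≤n⇒m<n∨m≡n a≤i
  ... | inj₁ a<i = inj₁ (squeeze a<i b≤j eq)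
  ... | inj₂ refl = inj₂ (refl , +-cancelˡ-≡ a j (suc b) (trans eq (sym (+-suc a b))))

  even≤odd⇒≤ : ∀ {a i} → 2 * a ≤ suc (2 * i) → a ≤ i
  even≤odd⇒≤ {a} {i} le = *-cancelˡ-≤ 2 (s≤s⁻¹ (≤∧≢⇒< le (even≢odd a i)))

  halve : ∀ {x y} → 2 * x ≡ 2 * y → x ≡ y
  halve {x} {y} = *-cancelˡ-≡ x y 2

-- In doubled coordinates q′ exceeds q by 2 in total and dominates ⌈q⌉; the coordinates
-- of r~ are odd and those of r even, which leaves only the four moves.
PairCond⇒Move : ∀ {n m} q q′ → Valid n m q → Valid n m q′ → PairCond q q′ → Move q q′
PairCond⇒Move (reg , a , b) (reg , i , j) _ _ (2a≤2i , 2b≤2j , eq)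
  with unit-step {i} {j} {a} {b} (*-cancelˡ-≤ 2 2a≤2i) (*-cancelˡ-≤ 2 2b≤2j) (halve (trans (l i j) (trans eq (r a b))))
  where
  l : ∀ i j → 2 * (i + j) ≡ 2 * i + 2 * j
  l = solve-∀
  r : ∀ a b → 2 * a + 2 * b + 2 ≡ 2 * suc (a + b)
  r = solve-∀
... | inj₁ (refl , refl) = down
... | inj₂ (refl , refl) = right
PairCond⇒Move (reg , a , b) (til , suc i , suc j) _ _ (2a≤ , 2b≤ , eq)
  rewrite 2*suc∸1 i | 2*suc∸1 j
  with squeeze {i} {j} {a} {b} (even≤odd⇒≤ 2a≤) (even≤odd⇒≤ 2b≤) (halve (+-cancelʳ-≡ 2 _ _ (trans (l i j) (trans eq (r a b)))))
  where
  l : ∀ i j → 2 * (i + j) + 2 ≡ suc (2 * i) + suc (2 * j)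
  l = solve-∀
  r : ∀ a b → 2 * a + 2 * b + 2 ≡ 2 * (a + b) + 2
  r = solve-∀
... | refl , refl = enter
PairCond⇒Move (til , suc a , suc b) q′ _ _ (2a≤ , 2b≤ , eq)
  with squeeze 2a≤ 2b≤ (trans eq (trans (cong₂ (λ x y → x + y + 2) (2*suc∸1 a) (2*suc∸1 b)) (r a b)))
  where
  r : ∀ a b → suc (2 * a) + suc (2 * b) + 2 ≡ 2 * suc a + 2 * suc b
  r = solve-∀
PairCond⇒Move (til , suc a , suc b) (reg , i , j) _ _ _ | dI≡ , dJ≡
  with halve {i} {suc a} dI≡ | halve {j} {suc b} dJ≡
... | refl | refl = leave
PairCond⇒Move (til , suc a , suc b) (til , suc i , j) _ _ _ | dI≡ , _ =
  ⊥-elim (even≢odd (suc a) i (sym (trans (sym (2*suc∸1 i)) dI≡)))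

Move⇒PairCond : ∀ {n m q q′} → Valid n m q → Move q q′ → PairCond q q′
Move⇒PairCond {q = reg , i , j} _ down = *-monoʳ-≤ 2 (n≤1+n i) , ≤-refl , shift i j
  where
  shift : ∀ i j → 2 * suc i + 2 * j ≡ 2 * i + 2 * j + 2
  shift = solve-∀
Move⇒PairCond {q = reg , i , j} _ right = ≤-refl , *-monoʳ-≤ 2 (n≤1+n j) , shift i j
  where
  shift : ∀ i j → 2 * i + 2 * suc j ≡ 2 * i + 2 * j + 2
  shift = solve-∀
Move⇒PairCond {q = reg , i , j} _ enter rewrite 2*suc∸1 i | 2*suc∸1 j = n≤1+n _ , n≤1+n _ , shift i j
  where
  shift : ∀ i j → suc (2 * i) + suc (2 * j) ≡ 2 * i + 2 * j + 2
  shift = solve-∀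
Move⇒PairCond {q = til , suc i , suc j} _ leave =
  ≤-refl , ≤-refl , trans (shift i j) (sym (cong₂ (λ x y → x + y + 2) (2*suc∸1 i) (2*suc∸1 j)))
  where
  shift : ∀ i j → 2 * suc i + 2 * suc j ≡ suc (2 * i) + suc (2 * j) + 2
  shift = solve-∀
Move⇒PairCond {q = til , zero , _} ((() , _) , _) leave
Move⇒PairCond {q = til , suc zero , _} ((s≤s () , _) , _) leave
Move⇒PairCond {q = til , suc (suc _) , zero} (_ , (() , _)) leave

module _ {n m′ : ℕ} where
  private
    m K : ℕ
    m = suc m′
    K = 2 * m ∸ 1

  Move⇒pos< : ∀ {q q′} → Valid n m q → Valid n m q′ → Move q q′ → pos m q < pos m q′
  Move⇒pos< {reg , suc a , b} _ _ down = +-monoˡ-< b (m<n+m (a * K) (subst (0 <_) (sym (2m∸1≡m′+m m′)) (<-≤-trans z<s (m≤n+m m m′))))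
  Move⇒pos< {reg , a , b} _ _ right = +-monoʳ-< ((a ∸ 1) * K) (n<1+n b)
  Move⇒pos< {reg , suc a , b} _ (_ , (_ , b+1≤m)) enter =
    m+n≤o⇒m≤o∸n (suc (a * K + b)) (begin
      suc (a * K + b) + suc b   ≡⟨ l (a * K) b ⟩
      a * K + (b + b) + 2       ≤⟨ +-monoˡ-≤ 2 (+-monoʳ-≤ (a * K) 2b≤K) ⟩
      a * K + K + 2             ≡⟨ cong (_+ 2) (+-comm (a * K) K) ⟩
      suc a * K + 2             ∎)
    where
    open ≤-Reasoning
    l : ∀ x b → suc (x + b) + suc b ≡ x + (b + b) + 2
    l = solve-∀
    2b≤K : b + b ≤ K
    2b≤K = subst (b + b ≤_) (sym (2m∸1≡m′+m m′)) (+-mono-≤ (s≤s⁻¹ b+1≤m) (≤-trans (s≤s⁻¹ b+1≤m) (n≤1+n m′)))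
  Move⇒pos< {til , suc a , suc (suc b)} _ _ leave = begin-strict
    (a * K + 2) ∸ (2 + b)  ≤⟨ ∸-monoʳ-≤ (a * K + 2) (m≤m+n 2 b) ⟩
    (a * K + 2) ∸ 2        ≡⟨ m+n∸n≡m (a * K) 2 ⟩
    a * K                  <⟨ m<m+n (a * K) z<s ⟩
    a * K + suc (suc b)    ∎
    where open ≤-Reasoning
  Move⇒pos< {reg , zero , _} ((() , _) , _) _ down
  Move⇒pos< {reg , zero , _} ((() , _) , _) _ enter
  Move⇒pos< {til , suc _ , zero} (_ , (() , _)) _ leave
  Move⇒pos< {til , suc _ , suc zero} (_ , (s≤s () , _)) _ leave
  Move⇒pos< {til , zero , _} ((() , _) , _) _ leave

hatTailᴱ : ℕ × ℕ → List (ℕ × ℕ) → List Elem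
hatTailᴱ (a , b) [] = []
hatTailᴱ (a , b) ((i , j) ∷ ps) =
  (if (i ≡ᵇ suc a) ∧ (j ≡ᵇ suc b) then (til , i , j) ∷ [ reg , i , j ] else [ reg , i , j ])
  ++ hatTailᴱ (i , j) ps

hatᴱ : List (ℕ × ℕ) → List Elem
hatᴱ [] = []
hatᴱ ((i , j) ∷ ps) = (reg , i , j) ∷ hatTailᴱ (i , j) ps

module _ (n c : ℕ) (d : ℕ → ℕ → ℕ) where

  hatTail≡map-hatTailᴱ : ∀ p ps → hatTail n c d p ps ≡ map (elt n c d) (hatTailᴱ p ps)
  hatTail≡map-hatTailᴱ p [] = refl
  hatTail≡map-hatTailᴱ (a , b) ((i , j) ∷ ps) with (i ≡ᵇ suc a) ∧ (j ≡ᵇ suc b)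
  ... | true = cong (λ t → elt n c d (til , i , j) ∷ elt n c d (reg , i , j) ∷ t) (hatTail≡map-hatTailᴱ (i , j) ps)
  ... | false = cong (elt n c d (reg , i , j) ∷_) (hatTail≡map-hatTailᴱ (i , j) ps)

  hat≡map-hatᴱ : ∀ P → hat n c d P ≡ map (elt n c d) (hatᴱ P)
  hat≡map-hatᴱ [] = refl
  hat≡map-hatᴱ ((i , j) ∷ ps) = cong (elt n c d (reg , i , j) ∷_) (hatTail≡map-hatTailᴱ (i , j) ps)

stepElems : ∀ {p q} → Step p q → List Elem
stepElems {q = i , j} diag = (til , i , j) ∷ [ reg , i , j ]
stepElems {q = i , j} down = [ reg , i , j ]
stepElems {q = i , j} right = [ reg , i , j ]

private
  ≡ᵇ-refl : ∀ a → (a ≡ᵇ a) ≡ true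
  ≡ᵇ-refl zero = refl
  ≡ᵇ-refl (suc a) = ≡ᵇ-refl a

  ≡ᵇ-suc : ∀ a → (a ≡ᵇ suc a) ≡ false
  ≡ᵇ-suc zero = refl
  ≡ᵇ-suc (suc a) = ≡ᵇ-suc a

hatTailᴱ-step : ∀ {a b i j} (s : Step (a , b) (i , j)) ps →
  hatTailᴱ (a , b) ((i , j) ∷ ps) ≡ stepElems s ++ hatTailᴱ (i , j) ps
hatTailᴱ-step {a} {b} diag ps rewrite ≡ᵇ-refl a | ≡ᵇ-refl b = refl
hatTailᴱ-step {a} {b} down ps rewrite ≡ᵇ-refl a | ≡ᵇ-suc b = refl
hatTailᴱ-step {a} {b} right ps rewrite ≡ᵇ-suc a = refl

moves⇒alignment : ∀ a b H {e} → Linked Move ((reg , a , b) ∷ H) → last ((reg , a , b) ∷ H) ≡ just (reg , e) →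
  ∃ λ ps → hatTailᴱ (a , b) ps ≡ H × Linked Step ((a , b) ∷ ps) × last ((a , b) ∷ ps) ≡ just e
moves⇒alignment a b [] _ eq with just-injective eq
... | refl = [] , refl , [-] , refl
moves⇒alignment a b ((reg , _) ∷ H) (down ∷ ms) eq with moves⇒alignment (suc a) b H ms eq
... | ps , refl , steps , eq′ = (suc a , b) ∷ ps , hatTailᴱ-step down ps , down ∷ steps , eq′
moves⇒alignment a b ((reg , _) ∷ H) (right ∷ ms) eq with moves⇒alignment a (suc b) H ms eq
... | ps , refl , steps , eq′ = (a , suc b) ∷ ps , hatTailᴱ-step right ps , right ∷ steps , eq′
moves⇒alignment a b ((til , _) ∷ []) (enter ∷ _) ()
moves⇒alignment a b ((til , _) ∷ (reg , _) ∷ H) (enter ∷ leave ∷ ms) eq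
  with moves⇒alignment (suc a) (suc b) H ms eq
... | ps , refl , steps , eq′ = (suc a , suc b) ∷ ps , hatTailᴱ-step diag ps , diag ∷ steps , eq′

module _ {n m : ℕ} where

  Point : ℕ × ℕ → Set
  Point (i , j) = Valid n m (reg , i , j)

  alignment⇒moves : ∀ a b ps {e} → Linked Step ((a , b) ∷ ps) → All Point ((a , b) ∷ ps) →
    last ((a , b) ∷ ps) ≡ just e →
    Linked Move (hatᴱ ((a , b) ∷ ps)) × All (Valid n m) (hatᴱ ((a , b) ∷ ps)) ×
    last (hatᴱ ((a , b) ∷ ps)) ≡ just (reg , e)
  alignment⇒moves a b [] _ (v ∷ []) refl = [-] , v ∷ [] , refl
  alignment⇒moves a b ((i , j) ∷ ps) (s ∷ steps) (v ∷ vs@(v′ ∷ _)) eq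
    rewrite hatTailᴱ-step s ps with alignment⇒moves i j ps steps vs eq | s
  ... | ms , valid , eq′ | down = down ∷ ms , v ∷ valid , eq′
  ... | ms , valid , eq′ | right = right ∷ ms , v ∷ valid , eq′
  ... | ms , valid , eq′ | diag = enter ∷ leave ∷ ms , v ∷ tilde-valid v v′ ∷ valid , eq′
    where
    tilde-valid : Point (a , b) → Point (suc a , suc b) → Valid n m (til , suc a , suc b)
    tilde-valid ((1≤a , _) , (1≤b , _)) ((_ , a<n) , (_ , b<m)) = (s≤s 1≤a , a<n) , (s≤s 1≤b , b<m)

_≤²_ : ℕ × ℕ → ℕ × ℕ → Set
(a , b) ≤² (a′ , b′) = a ≤ a′ × b ≤ b′

private
  ≤²-refl : ∀ {p} → p ≤² p
  ≤²-refl = ≤-refl , ≤-refl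

  ≤²-trans : ∀ {p q r} → p ≤² q → q ≤² r → p ≤² r
  ≤²-trans (a , b) (c , d) = ≤-trans a c , ≤-trans b d

  step⇒≤² : ∀ {p q} → Step p q → p ≤² q
  step⇒≤² diag = n≤1+n _ , n≤1+n _
  step⇒≤² down = n≤1+n _ , ≤-refl
  step⇒≤² right = ≤-refl , n≤1+n _

alignment-bounds : ∀ p ps {e} → Linked Step (p ∷ ps) → last (p ∷ ps) ≡ just e →
  All (λ q → p ≤² q × q ≤² e) (p ∷ ps)
alignment-bounds p [] _ refl = (≤²-refl , ≤²-refl) ∷ []
alignment-bounds p (p′ ∷ ps) (s ∷ steps) eq with alignment-bounds p′ ps steps eq
... | bounds@((_ , p′≤²e) ∷ _) =
  (≤²-refl , ≤²-trans (step⇒≤² s) p′≤²e) ∷ All.map (λ (p′≤²q , q≤²e) → ≤²-trans (step⇒≤² s) p′≤²q , q≤²e) bounds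

MaxInc⇔maximal : ∀ {T S} → MaxInc T S ⇔ (T ≢ [] × T ⊆ S × Increasing T × Maximal _<ʷ_ T S)
MaxInc⇔maximal = mk⇔
  (λ { (((T≢[] , T⊆S) , incT) , maxT) →
       T≢[] , T⊆S , incT , λ T′ T′⊆S incT′ T⊆T′ → maxT T′ ((nonempty T⊆T′ T≢[] , T′⊆S) , incT′) (T≢[] , T⊆T′) })
  (λ { (T≢[] , T⊆S , incT , maxT) →
       ((T≢[] , T⊆S) , incT) , λ { T′ ((_ , T′⊆S) , incT′) (_ , T⊆T′) → maxT T′ T′⊆S incT′ T⊆T′ } })
  where
  nonempty : ∀ {X Y : List WInt} → X ⊆ Y → X ≢ [] → Y ≢ []
  nonempty [] X≢[] _ = X≢[] refl

module Correspondence (n′ m′ c : ℕ) (d : ℕ → ℕ → ℕ) (hyp : PairHyp (suc n′) (suc m′) c d) where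

  n m : ℕ
  n = suc n′
  m = suc m′

  L : List Elem
  L = RElems n m

  el : Elem → WInt
  el = elt n c d

  _≺_ : Elem → Elem → Set
  _≺_ = _<_ on value n

  open Positions (pos m)

  L-consecutive : Consecutive 1 L
  L-consecutive = RElems-consecutive n′ m′

  el-injective : ∀ {x y} → Valid n m x → Valid n m y → el x ≡ el y → x ≡ y
  el-injective {x} {y} vx vy eq = value-injective n′ x y vx vy (cong proj₁ eq)

  valid-slice : ∀ a b → All (Valid n m) (Slice L a b)
  valid-slice a b = All-resp-⊆ (⊆-trans (take-⊆ (suc b ∸ a) _) (drop-⊆ (a ∸ 1) L)) (All.tabulate ∈RElems⇒Valid)

  IsMaxChain : List Elem → List Elem → Set
  IsMaxChain Q S = Q ≢ [] × Q ⊆ S × Linked _≺_ Q × Maximal _≺_ Q S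

  maxInc⇒maxChain : ∀ {T S} → All (Valid n m) S → MaxInc T (map el S) → ∃ λ Q → T ≡ map el Q × IsMaxChain Q S
  maxInc⇒maxChain {T} {S} vS maxT with Equivalence.to MaxInc⇔maximal maxT
  ... | T≢[] , T⊆ , incT , maxT′ with map-⊆-lift el el-injective S T⊆
  ...   | Q , refl , Q⊆S =
    Q , refl , T≢[] ∘ cong (map el) , Q⊆S , Linkedₚ.map⁻ incT , maximal-map⁻ el el-injective vS Q⊆S maxT′

  maxChain⇒maxInc : ∀ {Q S} → All (Valid n m) S → IsMaxChain Q S → MaxInc (map el Q) (map el S)
  maxChain⇒maxInc vS (Q≢[] , Q⊆S , incQ , maxQ) = Equivalence.from MaxInc⇔maximal
    (Q≢[] ∘ map-[] , Sublistₚ.map⁺ el Q⊆S , Linkedₚ.map⁺ incQ , maximal-map⁺ el el-injective vS Q⊆S maxQ)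
    where
    map-[] : ∀ {X : List Elem} → map el X ≡ [] → X ≡ []
    map-[] {[]} _ = refl

  move⇒pair-maximal : ∀ {x y} → Valid n m x → Valid n m y → Move x y →
    x ≺ y × Maximal _≺_ (x ∷ [ y ]) (Slice L (pos m x) (pos m y))
  move⇒pair-maximal {x} {y} vx vy mv
    with maxInc⇒maxChain (valid-slice (pos m x) (pos m y))
           (subst (MaxInc (el x ∷ [ el y ])) (Slice-map el L (pos m x) (pos m y))
             (Equivalence.from (hyp x y vx vy (Move⇒pos< vx vy mv)) (Move⇒PairCond vx mv)))
  ... | Q , eq , _ , Q⊆ , incQ , maxQ
    with map-injective el el-injective (vx ∷ vy ∷ []) (All-resp-⊆ Q⊆ (valid-slice (pos m x) (pos m y))) eq
  ... | refl with incQ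
  ...   | x≺y ∷ _ = x≺y , maxQ

  pair-maximal⇒move : ∀ {x y} → Valid n m x → Valid n m y → pos m x < pos m y →
    IsMaxChain (x ∷ [ y ]) (Slice L (pos m x) (pos m y)) → Move x y
  pair-maximal⇒move {x} {y} vx vy px<py chain =
    PairCond⇒Move x y vx vy (Equivalence.to (hyp x y vx vy px<py)
      (subst (MaxInc (el x ∷ [ el y ])) (sym (Slice-map el L (pos m x) (pos m y)))
        (maxChain⇒maxInc (valid-slice (pos m x) (pos m y)) chain)))

  adjacent-move : ∀ a b {Q} Q₁ {x y} Q₂ → Q ≡ Q₁ ++ x ∷ y ∷ Q₂ →
    Q ⊆ Slice L a b → Linked _≺_ Q → Maximal _≺_ Q (Slice L a b) → Move x y
  adjacent-move a b Q₁ {x} {y} Q₂ refl Q⊆ incQ maxQ with ⊆-around Q₁ Q⊆ | Slice-infix L a b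
  ... | S₁ , S₂′ , eS , Q₁⊆ , yQ₂⊆ | B , C , eL with ⊆-around [] yQ₂⊆
  ...   | Mid , S₂ , refl , _ , Q₂⊆ =
    pair-maximal⇒move (valid x∈S) (valid y∈S) px<py
      ((λ ()) , subst (x ∷ [ y ] ⊆_) (sym sxy) (refl ∷ ++⁺ˡ Mid (refl ∷ [])) , x≺y ∷ [-] ,
       subst (Maximal _≺_ (x ∷ [ y ])) (sym sxy)
         (maximal-pair _≺_ Q₁ Q₂ S₁ Mid S₂ x∉ (y∉ ∘ there) Q₁⊆ Q₂⊆ incQ (subst (Maximal _≺_ _) eS maxQ)))
    where
    eL′ : L ≡ (B ++ S₁) ++ x ∷ Mid ++ y ∷ S₂ ++ C
    eL′ = trans eL (trans (cong (λ S → B ++ S ++ C) eS)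
            (trans (cong (B ++_) (trans (++-assoc S₁ _ C) (cong (λ t → S₁ ++ x ∷ t) (++-assoc Mid (y ∷ S₂) C))))
              (sym (++-assoc B S₁ _))))
    sxy : Slice L (pos m x) (pos m y) ≡ x ∷ Mid ++ [ y ]
    sxy = slice-infix L-consecutive (Mid ++ [ y ]) (x ∷ Mid)
            (trans eL′ (cong (λ t → (B ++ S₁) ++ x ∷ t) (sym (++-assoc Mid [ y ] (S₂ ++ C))))) refl
    x∉ : x ∉ Mid ++ [ y ]
    x∉ = proj₂ (slice-∉ L-consecutive (pos m x) (pos m y) [] (Mid ++ [ y ]) sxy)
    y∉ : y ∉ x ∷ Mid
    y∉ = proj₁ (slice-∉ L-consecutive (pos m x) (pos m y) (x ∷ Mid) [] sxy)
    px<py : pos m x < pos m y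
    px<py = consecutive-< L-consecutive (B ++ S₁) Mid eL′
    valid : ∀ {w} → w ∈ Slice L a b → Valid n m w
    valid = All.lookup (valid-slice a b)
    x∈S : x ∈ Slice L a b
    x∈S = lookup Q⊆ (∈-++⁺ʳ Q₁ (here refl))
    y∈S : y ∈ Slice L a b
    y∈S = lookup Q⊆ (∈-++⁺ʳ Q₁ (there (here refl)))
    x≺y : x ≺ y
    x≺y = Linked.head (linked-++⁻ʳ Q₁ incQ)

  maximal⇒moves : ∀ a b {Q} → Q ⊆ Slice L a b → Linked _≺_ Q → Maximal _≺_ Q (Slice L a b) → Linked Move Q
  maximal⇒moves a b {Q} Q⊆ incQ maxQ = moves [] Q refl
    where
    moves : ∀ Q₁ Q₂ → Q ≡ Q₁ ++ Q₂ → Linked Move Q₂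
    moves Q₁ [] _ = []
    moves Q₁ (x ∷ []) _ = [-]
    moves Q₁ (x ∷ y ∷ Q₂) eq =
      adjacent-move a b Q₁ Q₂ eq Q⊆ incQ maxQ ∷
      moves (Q₁ ++ [ x ]) (y ∷ Q₂) (trans eq (sym (++-assoc Q₁ [ x ] (y ∷ Q₂))))

  moves⇒maximal : ∀ x Q {z} → Linked Move (x ∷ Q) → All (Valid n m) (x ∷ Q) → last (x ∷ Q) ≡ just z →
    pos m x ≤ pos m z × x ∷ Q ⊆ Slice L (pos m x) (pos m z) × Linked _≺_ (x ∷ Q) ×
    Maximal _≺_ (x ∷ Q) (Slice L (pos m x) (pos m z))
  moves⇒maximal x [] _ (vx ∷ []) refl =
    ≤-refl , subst (x ∷ [] ⊆_) (sym sxx) ⊆-refl , [-] , subst (Maximal _≺_ [ x ]) (sym sxx) (maximal-[x] _≺_ x)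
    where
    sxx : Slice L (pos m x) (pos m x) ≡ [ x ]
    sxx = slice-point L-consecutive (Valid⇒∈RElems x vx)
  moves⇒maximal x (y ∷ Q) {z} (mv ∷ mvs) (vx ∷ vs@(vy ∷ _)) eq
    with moves⇒maximal y Q mvs vs eq | move⇒pair-maximal vx vy mv
  ... | py≤pz , yQ⊆ , incY , maxY | x≺y , maxXY
    with slice-split L-consecutive (Valid⇒∈RElems x vx) (Valid⇒∈RElems y vy) (Valid⇒∈RElems z vz) px<py py≤pz
    where
    px<py : pos m x < pos m y
    px<py = Move⇒pos< vx vy mv
    vz : Valid n m z
    vz = All.lookup vs (last⇒∈ (y ∷ Q) eq)
  ... | Mid , S₂ , sxy , syz , sxz =
    <⇒≤ (<-≤-trans (Move⇒pos< vx vy mv) py≤pz) ,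
    subst (x ∷ y ∷ Q ⊆_) (sym sxz) (refl ∷ ++⁺ˡ Mid (subst (y ∷ Q ⊆_) syz yQ⊆)) ,
    x≺y ∷ incY ,
    subst (Maximal _≺_ (x ∷ y ∷ Q)) (sym sxz)
      (maximal-glue _≺_ Mid S₂ Q x∉ (y∉x∷Mid ∘ there) y∉S₂
        (subst (Maximal _≺_ (x ∷ [ y ])) sxy maxXY) (subst (Maximal _≺_ (y ∷ Q)) syz maxY))
    where
    x∉ : x ∉ Mid ++ y ∷ S₂
    x∉ = proj₂ (slice-∉ L-consecutive (pos m x) (pos m z) [] (Mid ++ y ∷ S₂) sxz)
    y∉x∷Mid : y ∉ x ∷ Mid
    y∉x∷Mid = proj₁ (slice-∉ L-consecutive (pos m x) (pos m z) (x ∷ Mid) S₂ sxz)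
    y∉S₂ : y ∉ S₂
    y∉S₂ = proj₂ (slice-∉ L-consecutive (pos m x) (pos m z) (x ∷ Mid) S₂ sxz)

  module Endpoints {i⊢ i⊣ j⊢ j⊣ : ℕ} (1≤i⊢ : 1 ≤ i⊢) (i⊢≤i⊣ : i⊢ ≤ i⊣) (i⊣≤n : i⊣ ≤ n)
                   (1≤j⊢ : 1 ≤ j⊢) (j⊢≤j⊣ : j⊢ ≤ j⊣) (j⊣≤m : j⊣ ≤ m) where

    q₀ qₑ : Elem
    q₀ = reg , i⊢ , j⊢
    qₑ = reg , i⊣ , j⊣

    v₀ : Valid n m q₀
    v₀ = (1≤i⊢ , ≤-trans i⊢≤i⊣ i⊣≤n) , (1≤j⊢ , ≤-trans j⊢≤j⊣ j⊣≤m)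

    vₑ : Valid n m qₑ
    vₑ = (≤-trans 1≤i⊢ i⊢≤i⊣ , i⊣≤n) , (≤-trans 1≤j⊢ j⊢≤j⊣ , j⊣≤m)

    S : List Elem
    S = Slice L (pos m q₀) (pos m qₑ)

    BandedMaxInc : List WInt → Set
    BandedMaxInc Q = Banded (rv n i⊢ j⊢) (rv n i⊣ j⊣) Q × MaxInc Q (Slice (Rseq n m c d) (fpos m i⊢ j⊢) (fpos m i⊣ j⊣))

    S-shape : ∃₂ λ M M₀ → S ≡ q₀ ∷ M × q₀ ∷ M ≡ M₀ ++ [ qₑ ]
    S-shape with segment L-consecutive (Valid⇒∈RElems q₀ v₀) (Valid⇒∈RElems qₑ vₑ)
                   (+-mono-≤ (*-monoˡ-≤ (2 * m ∸ 1) (∸-monoˡ-≤ 1 i⊢≤i⊣)) j⊢≤j⊣)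
    ... | B , C , M , M₀ , eL , eM = M , M₀ , slice-infix L-consecutive M M₀ eL eM , eM

    valid-S : ∀ {w} → w ∈ S → Valid n m w
    valid-S = All.lookup (valid-slice (pos m q₀) (pos m qₑ))

    starts-at-q₀ : ∀ {Q M} → S ≡ q₀ ∷ M → IsMaxChain Q S → All (λ w → value n q₀ ≤ value n w) Q →
      ∃ λ H → Q ≡ q₀ ∷ H
    starts-at-q₀ {Q} {M} eS (Q≢[] , Q⊆S , incQ , maxQ) =
      maximal-starts-at-minimum (value n) Q Q≢[] (subst (Q ⊆_) eS Q⊆S) incQ (subst (Maximal _≺_ Q) eS maxQ) q₀-unique
      where
      q₀∉M : q₀ ∉ M
      q₀∉M = proj₂ (slice-∉ L-consecutive (pos m q₀) (pos m qₑ) [] M eS)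
      q₀-unique : ∀ {w} → w ∈ M → value n q₀ ≢ value n w
      q₀-unique w∈M eq =
        q₀∉M (subst (_∈ M) (sym (value-injective n′ q₀ _ v₀ (valid-S (subst (_ ∈_) (sym eS) (there w∈M))) eq)) w∈M)

    ends-at-qₑ : ∀ {Q M₀} → S ≡ M₀ ++ [ qₑ ] → IsMaxChain Q S → All (λ w → value n w ≤ value n qₑ) Q →
      last Q ≡ just qₑ
    ends-at-qₑ {Q} {M₀} eS (Q≢[] , Q⊆S , incQ , maxQ) =
      maximal-ends-at-maximum (value n) M₀ Q Q≢[] (subst (Q ⊆_) eS Q⊆S) incQ (subst (Maximal _≺_ Q) eS maxQ) qₑ-unique
      where
      qₑ∉M₀ : qₑ ∉ M₀
      qₑ∉M₀ = proj₁ (slice-∉ L-consecutive (pos m q₀) (pos m qₑ) M₀ [] eS)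
      qₑ-unique : ∀ {w} → w ∈ M₀ → value n w ≢ value n qₑ
      qₑ-unique w∈M₀ eq =
        qₑ∉M₀ (subst (_∈ M₀) (value-injective n′ _ qₑ (valid-S (subst (_ ∈_) (sym eS) (∈-++⁺ˡ w∈M₀))) vₑ eq) w∈M₀)

    banded-maximal⇒alignment : ∀ Q → BandedMaxInc Q → ∃ λ P → IsAlignment i⊢ j⊢ i⊣ j⊣ P × Q ≡ hat n c d P
    banded-maximal⇒alignment Q (band , maxQ)
      with maxInc⇒maxChain (valid-slice (pos m q₀) (pos m qₑ)) (subst (MaxInc Q) (Slice-map el L (pos m q₀) (pos m qₑ)) maxQ)
         | S-shape
    ... | Qᴱ , refl , chain@(_ , Qᴱ⊆S , incQ , maxQᴱ) | M , M₀ , eS , eM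
      with starts-at-q₀ eS chain (All.map proj₁ (Allₚ.map⁻ band))
         | ends-at-qₑ (trans eS eM) chain (All.map proj₂ (Allₚ.map⁻ band))
    ... | H , refl | lastQ with moves⇒alignment i⊢ j⊢ H (maximal⇒moves (pos m q₀) (pos m qₑ) Qᴱ⊆S incQ maxQᴱ) lastQ
    ... | ps , refl , steps , lastP =
      (i⊢ , j⊢) ∷ ps , (refl , lastP , steps) , sym (hat≡map-hatᴱ n c d ((i⊢ , j⊢) ∷ ps))

    alignment⇒banded-maximal : ∀ Q → (∃ λ P → IsAlignment i⊢ j⊢ i⊣ j⊣ P × Q ≡ hat n c d P) → BandedMaxInc Q
    alignment⇒banded-maximal Q ([] , (() , _) , _)
    alignment⇒banded-maximal Q ((a , b) ∷ ps , (hd , lastP , steps) , refl) with just-injective hd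
    ... | refl with alignment⇒moves i⊢ j⊢ ps steps (All.map in-range (alignment-bounds (i⊢ , j⊢) ps steps lastP)) lastP
      where
      in-range : ∀ {q} → (i⊢ , j⊢) ≤² q × q ≤² (i⊣ , j⊣) → Point {n} {m} q
      in-range ((i⊢≤i , j⊢≤j) , (i≤i⊣ , j≤j⊣)) =
        (≤-trans 1≤i⊢ i⊢≤i , ≤-trans i≤i⊣ i⊣≤n) , (≤-trans 1≤j⊢ j⊢≤j , ≤-trans j≤j⊣ j⊣≤m)
    ... | moves , validH , lastH with moves⇒maximal q₀ (hatTailᴱ (i⊢ , j⊢) ps) moves validH lastH
    ... | _ , H⊆S , incH , maxH =
      subst BandedMaxInc (sym (hat≡map-hatᴱ n c d ((i⊢ , j⊢) ∷ ps)))
        (Allₚ.map⁺ (All.zip (linked⇒≥head (value n) incH , linked⇒≤last (value n) _ incH lastH)) ,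
         subst (MaxInc (map el (hatᴱ ((i⊢ , j⊢) ∷ ps)))) (sym (Slice-map el L (pos m q₀) (pos m qₑ)))
           (maxChain⇒maxInc (valid-slice (pos m q₀) (pos m qₑ)) ((λ ()) , H⊆S , incH , maxH)))

lemma1 : {X : Set} (A B : List⁺ X) (d : ℕ → ℕ → ℕ) →
    PairHyp (length A) (length B) (cmax (length A) (length B) d) d →
    (i⊢ i⊣ j⊢ j⊣ : ℕ) →
    1 ≤ i⊢ → i⊢ ≤ i⊣ → i⊣ ≤ length A → 1 ≤ j⊢ → j⊢ ≤ j⊣ → j⊣ ≤ length B →
    (Q : List WInt) →
    Subseq Q (Rseq (length A) (length B) (cmax (length A) (length B) d) d) →
    ((Banded (rv (length A) i⊢ j⊢) (rv (length A) i⊣ j⊣) Q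
       × MaxInc Q (Slice (Rseq (length A) (length B) (cmax (length A) (length B) d) d)
                         (fpos (length B) i⊢ j⊢) (fpos (length B) i⊣ j⊣)))
     ⇔ ∃ (λ P → IsAlignment i⊢ j⊢ i⊣ j⊣ P
                × Q ≡ hat (length A) (cmax (length A) (length B) d) d P))
lemma1 A@(_ ∷ as) B@(_ ∷ bs) d hyp i⊢ i⊣ j⊢ j⊣ 1≤i⊢ i⊢≤i⊣ i⊣≤n 1≤j⊢ j⊢≤j⊣ j⊣≤m Q _ =
  mk⇔ (banded-maximal⇒alignment Q) (alignment⇒banded-maximal Q)
  where
  open Correspondence (List.length as) (List.length bs) (cmax (length A) (length B) d) d hyp
  open Endpoints 1≤i⊢ i⊢≤i⊣ i⊣≤n 1≤j⊢ j⊢≤j⊣ j⊣≤m
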